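{- Let $m$ be an integer such that $q=4m^2+4m+3$ is a prime power. Let $P=\mathbb{F}_q$ and $\mathcal{B}=\{\{x+a: x\in C_0^{(2,q)}\cup\{0\}\}: a\in\mathbb{F}_q\}$, where $C_0^{(2,q)}$ is the set of nonzero squares of $\mathbb{F}_q$. Assume there is a four-intersection set with parameters $(2m^2+m+2;\{m^2+1,m^2+2,m^2+m+1,m^2+m+2\})$ for $(P,\mathcal{B})$. Then there exists a biregular Hadamard matrix $H'$ of order $n=4(m^2+m+1)$ such that the entries of $H'\mathbf{1}_n$ are $2m-2$ and $2m+2$.
   Context: Given a point set $P$ and a family $\mathcal{B}$ of subsets (blocks), a $j$-subset $D\subseteq P$ is a $t$-intersection set with parameters $(j;\{\alpha_1,\dots,\alpha_t\})$ for $(P,\mathcal{B})$ if $\{|B\cap D|:B\in\mathcal{B}\}=\{\alpha_1,\dots,\alpha_t\}$. An Hadamard matrix of order $n$ is an $n\times n$ $\{1,-1\}$-matrix $H$ with $HH^{\top}=nI_n$; it is biregular if the entries of $H\mathbf{1}_n$ ($\mathbf{1}_n$ the all-one vector) take exactly two values, both nonnegative integers. -}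

module Defs where

open import Data.Nat using (ℕ; zero; suc)
open import Data.Integer using (ℤ; +_; 0ℤ) renaming (_+_ to _+ℤ_; _*_ to _*ℤ_; -_ to -ℤ_)
open import Data.Fin using (Fin; _≟_)
open import Data.Fin.Properties using (any?)
open import Data.Fin.Subset using (Subset; _∩_; ∣_∣)
open import Data.Vec using (tabulate)
open import Data.List using (List)
open import Data.List.Membership.Propositional using (_∈_)
open import Data.List.Relation.Unary.Unique.Propositional using (Unique)
open import Data.Product using (Σ; ∃; _×_; _,_)
open import Data.Sum using (_⊎_)
open import Relation.Nullary using (¬_; does)
open import Relation.Binary.PropositionalEquality using (_≡_; _≢_)
open import Algebra.Structures using (IsCommutativeRing)
open import Level using (0ℓ)

-- A finite field with q elements, realised on the carrier Fin q
-- (every finite field of order q is isomorphic to such a structure).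

record FiniteField (q : ℕ) : Set where
  field
    _+_ _*_ : Fin q → Fin q → Fin q
    -_      : Fin q → Fin q
    0# 1#   : Fin q
    isCommutativeRing : IsCommutativeRing _≡_ _+_ _*_ -_ 0# 1#
    0≢1     : 0# ≢ 1#
    inverse : ∀ x → x ≢ 0# → ∃ λ y → x * y ≡ 1#
  infixl 6 _+_
  infixl 7 _*_

module _ {q : ℕ} (F : FiniteField q) where
  open FiniteField F

  IsSquareOrZero : Fin q → Set
  IsSquareOrZero z = ∃ λ y → y * y ≡ z

  squareBlock : Fin q → Subset q
  squareBlock a = tabulate λ z → does (any? λ y → (y * y + a) ≟ z)

-- The blocks are given as an indexed family
-- (the family B is its image).

IsIntersectionSet : ∀ {n} {I : Set} → (I → Subset n) → ℕ → List ℕ → Subset n → Set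
IsIntersectionSet {n} {I} blocks j αs D =
  (∣ D ∣ ≡ j) ×
  Unique αs ×
  (∀ (i : I) → ∣ blocks i ∩ D ∣ ∈ αs) ×
  (∀ α → α ∈ αs → ∃ λ (i : I) → ∣ blocks i ∩ D ∣ ≡ α)

sumℤ : ∀ {n} → (Fin n → ℤ) → ℤ
sumℤ {zero}  f = 0ℤ
sumℤ {suc n} f = f Fin.zero +ℤ sumℤ (λ i → f (Fin.suc i))

Matrix : ℕ → Set
Matrix n = Fin n → Fin n → ℤ

IsHadamard : ∀ n → Matrix n → Set
IsHadamard n H =
  (∀ i k → H i k ≡ + 1 ⊎ H i k ≡ -ℤ (+ 1)) ×
  (∀ i k → (i ≡ k → sumℤ (λ l → H i l *ℤ H k l) ≡ + n) ×
           (i ≢ k → sumℤ (λ l → H i l *ℤ H k l) ≡ 0ℤ))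

rowSum : ∀ {n} → Matrix n → Fin n → ℤ
rowSum H i = sumℤ (H i)

RowSumsAre : ∀ {n} → Matrix n → ℤ → ℤ → Set
RowSumsAre H a b =
  (∀ i → rowSum H i ≡ a ⊎ rowSum H i ≡ b) ×
  (∃ λ i → rowSum H i ≡ a) × (∃ λ i → rowSum H i ≡ b)

IsBiregular : ∀ {n} → Matrix n → Set
IsBiregular H = Σ ℕ λ a → Σ ℕ λ b → (a ≢ b) × RowSumsAre H (+ a) (+ b)

module Submission where

-- For q ≡ 3 (mod 4) the Paley matrix of order q + 1 (a row of 1s and a column of -1s bordering
-- the ±1 incidence matrix of the blocks squares + a) is Hadamard, because the quadratic character χ
-- is multiplicative, sums to 0, has χ (-1) = -1 and satisfies Jacobsthal's Σₓ χ x χ (x + a) = -1.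
-- Negating the border column and the columns of D keeps it Hadamard and makes the row sums
-- q - 1 - 2|D| and 2 + 2|D| - 4|B ∩ D|. With |D| = 2m² + m + 2 and |B ∩ D| ∈ {m²+1, m²+2, m²+m+1, m²+m+2}
-- these are ±(2m - 2) and ±(2m + 2); negating the rows with negative sum gives the biregular matrix.

open import Defs
open import Data.Nat as ℕ using (ℕ; zero; suc)
import Data.Nat.Properties as ℕ
open import Data.Nat.Tactic.RingSolver using () renaming (solve-∀ to ℕ-solve-∀)
open import Data.Integer as ℤ using (ℤ; +_; -[1+_]; 0ℤ; _+_; _*_; -_; _-_; _≤_; ∣_∣)
import Data.Integer.Properties as ℤ
open import Data.Integer.Tactic.RingSolver using (solve-∀)
open import Data.Bool using (Bool; true; false; not; _∧_)
open import Data.Fin using (Fin; zero; suc; toℕ; _≟_)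
open import Data.Fin.Properties using (toℕ-injective; any?)
import Data.Fin.Permutation as Perm
open import Data.Fin.Subset using (Subset; _∩_)
import Data.Fin.Subset as Subset
open import Data.Vec using (lookup; _∷_; [])
open import Data.Vec.Properties using (lookup-zipWith; lookup∘tabulate)
open import Data.List using (List; _∷_; [])
open import Data.List.Membership.Propositional using (_∈_)
open import Data.List.Relation.Unary.Any using (here; there)
open import Data.List.Relation.Unary.All using (_∷_)
open import Data.List.Relation.Unary.AllPairs using (_∷_)
open import Data.Product using (Σ; _×_; ∃; _,_; proj₁; proj₂)
open import Data.Sum using (_⊎_; inj₁; inj₂; [_,_]′)
open import Function using (_∘_; _⇔_; mk⇔)
open import Relation.Nullary using (Dec; does; yes; no; ¬_)
open import Relation.Nullary.Negation using (contradiction)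
open import Relation.Nullary.Decidable using (dec-true; dec-false; does-⇔)
open import Relation.Binary.Definitions using (tri<; tri≈; tri>)
open import Relation.Binary.PropositionalEquality
open import Algebra.Bundles using (AbelianGroup; CommutativeRing)
open import Algebra.Structures using (IsCommutativeRing)
open import Algebra.Properties.CommutativeMonoid.Sum ℤ.+-0-commutativeMonoid
  using (sum; sum-cong-≗; sum-replicate-zero; ∑-distrib-+; ∑-comm; sum-permute)
open import Algebra.Properties.Semiring.Sum ℤ.+-*-semiring using (*-distribˡ-sum)
open import Algebra.Properties.Group (AbelianGroup.group ℤ.+-0-abelianGroup) using ()
  renaming (∙-cancelˡ to +-cancelˡ)

⟦_⟧ : Bool → ℤ
⟦ true  ⟧ = + 1
⟦ false ⟧ = 0ℤ

signed : Bool → ℤ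
signed true  = + 1
signed false = - + 1

⟦∧⟧ : ∀ a b → ⟦ a ∧ b ⟧ ≡ ⟦ a ⟧ * ⟦ b ⟧
⟦∧⟧ true  true  = refl
⟦∧⟧ true  false = refl
⟦∧⟧ false b     = refl

signed-not : ∀ b → signed (not b) ≡ + 1 - + 2 * ⟦ b ⟧
signed-not true  = refl
signed-not false = refl

signed-*-signed-not : ∀ b d → signed b * signed (not d) ≡ signed b - + 4 * (⟦ b ⟧ * ⟦ d ⟧) + + 2 * ⟦ d ⟧
signed-*-signed-not true  true  = refl
signed-*-signed-not true  false = refl
signed-*-signed-not false true  = refl
signed-*-signed-not false false = refl

IsSign : ℤ → Set
IsSign z = z ≡ + 1 ⊎ z ≡ - + 1

signed-isSign : ∀ b → IsSign (signed b)
signed-isSign true  = inj₁ refl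
signed-isSign false = inj₂ refl

isSign-* : ∀ {a b} → IsSign a → IsSign b → IsSign (a * b)
isSign-* (inj₁ refl) (inj₁ refl) = inj₁ refl
isSign-* (inj₁ refl) (inj₂ refl) = inj₂ refl
isSign-* (inj₂ refl) (inj₁ refl) = inj₂ refl
isSign-* (inj₂ refl) (inj₂ refl) = inj₁ refl

isSign-square : ∀ {a} → IsSign a → a * a ≡ + 1
isSign-square (inj₁ refl) = refl
isSign-square (inj₂ refl) = refl

signum : ℤ → ℤ
signum (+ _)    = + 1
signum -[1+ _ ] = - + 1

signum-isSign : ∀ z → IsSign (signum z)
signum-isSign (+ _)    = inj₁ refl
signum-isSign -[1+ _ ] = inj₂ refl

signum-* : ∀ z → signum z * z ≡ + ∣ z ∣
signum-* (+ n)      = ℤ.*-identityˡ (+ n)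
signum-* -[1+ n ]   = ℤ.-1*i≡-i -[1+ n ]

even≢odd : ∀ (c : ℤ) k → c + c ≢ + suc (2 ℕ.* k)
even≢odd (+ c)    k eq = ℕ.even≢odd c k (trans (cong (c ℕ.+_) (ℕ.+-identityʳ c)) (ℤ.+-injective eq))
even≢odd -[1+ c ] k ()

double-injective : ∀ {a b : ℤ} → a + a ≡ b + b → a ≡ b
double-injective {a} {b} a+a≡b+b = ℤ.*-cancelˡ-≡ (+ 2) a b (trans (sym (double a)) (trans a+a≡b+b (double b)))
  where
  double : ∀ x → x + x ≡ + 2 * x
  double = solve-∀

does⇒ : ∀ {A : Set} (a? : Dec A) → does a? ≡ true → A
does⇒ (yes a) _ = a

sumℤ≗sum : ∀ {n} (f : Fin n → ℤ) → sumℤ f ≡ sum f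
sumℤ≗sum {zero}  f = refl
sumℤ≗sum {suc n} f = cong (λ s → f zero + s) (sumℤ≗sum (f ∘ suc))

sum-ones : ∀ n → sum {n} (λ _ → + 1) ≡ + n
sum-ones zero    = refl
sum-ones (suc n) = cong (λ s → + 1 + s) (sum-ones n)

sum-*ˡ : ∀ {n} c (f : Fin n → ℤ) → sum (λ i → c * f i) ≡ c * sum f
sum-*ˡ c f = sym (*-distribˡ-sum c f)

sum-neg : ∀ {n} (f : Fin n → ℤ) → sum (λ i → - f i) ≡ - sum f
sum-neg f = begin
  sum (λ i → - f i)      ≡⟨ sum-cong-≗ (λ i → sym (ℤ.-1*i≡-i (f i))) ⟩
  sum (λ i → - + 1 * f i) ≡⟨ sum-*ˡ (- + 1) f ⟩
  - + 1 * sum f          ≡⟨ ℤ.-1*i≡-i (sum f) ⟩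
  - sum f                ∎
  where open ≡-Reasoning

sum-- : ∀ {n} (f g : Fin n → ℤ) → sum (λ i → f i - g i) ≡ sum f - sum g
sum-- f g = trans (∑-distrib-+ f (λ i → - g i)) (cong (λ s → sum f + s) (sum-neg g))

sum-bijection : ∀ {n} (f : Fin n → ℤ) (π π⁻¹ : Fin n → Fin n) →
                (∀ y → π (π⁻¹ y) ≡ y) → (∀ x → π⁻¹ (π x) ≡ x) →
                sum (f ∘ π) ≡ sum f
sum-bijection f π π⁻¹ inv₁ inv₂ = sym (sum-permute f (Perm.permutation π π⁻¹ inv₁ inv₂))

sum-delta : ∀ {n} (a : Fin n) (g : Fin n → ℤ) → sum (λ x → ⟦ does (x ≟ a) ⟧ * g x) ≡ g a
sum-delta {suc n} zero g = begin
  + 1 * g zero + sum (λ x → 0ℤ * g (suc x)) ≡⟨ cong₂ _+_ (ℤ.*-identityˡ (g zero)) (sum-cong-≗ (λ x → ℤ.*-zeroˡ (g (suc x)))) ⟩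
  g zero + sum {n} (λ _ → 0ℤ)               ≡⟨ cong (λ s → g zero + s) (sum-replicate-zero n) ⟩
  g zero + 0ℤ                               ≡⟨ ℤ.+-identityʳ (g zero) ⟩
  g zero                                    ∎
  where open ≡-Reasoning
sum-delta {suc n} (suc a) g = begin
  0ℤ * g zero + sum (λ x → ⟦ does (suc x ≟ suc a) ⟧ * g (suc x))
    ≡⟨ cong₂ _+_ (ℤ.*-zeroˡ (g zero)) (sum-cong-≗ λ x → cong (λ b → ⟦ b ⟧ * g (suc x)) (does-suc x)) ⟩
  0ℤ + sum (λ x → ⟦ does (x ≟ a) ⟧ * g (suc x))               ≡⟨ ℤ.+-identityˡ _ ⟩
  sum (λ x → ⟦ does (x ≟ a) ⟧ * g (suc x))                    ≡⟨ sum-delta a (g ∘ suc) ⟩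
  g (suc a)                                                    ∎
  where
  open ≡-Reasoning
  does-suc : ∀ x → does (suc x ≟ suc a) ≡ does (x ≟ a)
  does-suc x with x ≟ a
  ... | yes _ = refl
  ... | no  _ = refl

sum-pick : ∀ {n} (P : Fin n → Bool) (a : Fin n) → P a ≡ true → (∀ x → P x ≡ true → x ≡ a) →
           (g : Fin n → ℤ) → sum (λ x → ⟦ P x ⟧ * g x) ≡ g a
sum-pick P a Pa unique g = trans (sum-cong-≗ P≗delta) (sum-delta a g)
  where
  P≗delta : ∀ x → ⟦ P x ⟧ * g x ≡ ⟦ does (x ≟ a) ⟧ * g x
  P≗delta x with x ≟ a | P x in Px
  ... | yes refl | true  = refl
  ... | yes refl | false = contradiction (trans (sym Px) Pa) λ ()
  ... | no  x≢a  | true  = contradiction (unique x Px) x≢a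
  ... | no  _    | false = refl

sum-indicator-unique : ∀ {n} (P : Fin n → Bool) (a : Fin n) → P a ≡ true → (∀ x → P x ≡ true → x ≡ a) →
                       sum (⟦_⟧ ∘ P) ≡ + 1
sum-indicator-unique P a Pa unique =
  trans (sum-cong-≗ (λ x → sym (ℤ.*-identityʳ ⟦ P x ⟧))) (sum-pick P a Pa unique (λ _ → + 1))

sum-mono-≤ : ∀ {n} {f g : Fin n → ℤ} → (∀ i → f i ≤ g i) → sum f ≤ sum g
sum-mono-≤ {zero}  f≤g = ℤ.≤-refl
sum-mono-≤ {suc n} f≤g = ℤ.+-mono-≤ (f≤g zero) (sum-mono-≤ (f≤g ∘ suc))

≤∧sum-≡⇒≗ : ∀ {n} {f g : Fin n → ℤ} → (∀ i → f i ≤ g i) → sum f ≡ sum g → ∀ i → f i ≡ g i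
≤∧sum-≡⇒≗ {suc n} {f} {g} f≤g Σf≡Σg = λ where
    zero    → heads-equal
    (suc i) → ≤∧sum-≡⇒≗ (f≤g ∘ suc) tails-equal i
  where
  heads-equal : f zero ≡ g zero
  heads-equal with f zero ℤ.≟ g zero
  ... | yes f₀≡g₀ = f₀≡g₀
  ... | no  f₀≢g₀ = contradiction Σf≡Σg (ℤ.<⇒≢ (ℤ.+-mono-<-≤ (ℤ.≤∧≢⇒< (f≤g zero) f₀≢g₀) (sum-mono-≤ (f≤g ∘ suc))))
  tails-equal : sum (f ∘ suc) ≡ sum (g ∘ suc)
  tails-equal = +-cancelˡ (g zero) _ _ (trans (cong (_+ sum (f ∘ suc)) (sym heads-equal)) Σf≡Σg)

sum-subset : ∀ {n} (p : Subset n) → sum (⟦_⟧ ∘ lookup p) ≡ + Subset.∣ p ∣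
sum-subset []          = refl
sum-subset (true ∷ p)  = cong (λ s → + 1 + s) (sum-subset p)
sum-subset (false ∷ p) = trans (ℤ.+-identityˡ _) (sum-subset p)

sum-∩ : ∀ {n} (p r : Subset n) → sum (λ i → ⟦ lookup p i ⟧ * ⟦ lookup r i ⟧) ≡ + Subset.∣ p ∩ r ∣
sum-∩ p r = trans (sum-cong-≗ lookup-∩) (sum-subset (p ∩ r))
  where
  lookup-∩ : ∀ i → ⟦ lookup p i ⟧ * ⟦ lookup r i ⟧ ≡ ⟦ lookup (p ∩ r) i ⟧
  lookup-∩ i = trans (sym (⟦∧⟧ (lookup p i) (lookup r i))) (cong ⟦_⟧ (sym (lookup-zipWith _∧_ i p r)))

involution-count≢odd : ∀ {n} (ι : Fin n → Fin n) → (∀ x → ι (ι x) ≡ x) →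
                       (P : Fin n → Bool) → (∀ x → P (ι x) ≡ P x) → (∀ x → P x ≡ true → ι x ≢ x) →
                       ∀ k → sum (⟦_⟧ ∘ P) ≢ + suc (2 ℕ.* k)
involution-count≢odd ι ιι P Pι fixpoint-free k Σ≡odd = even≢odd (sum first) k (trans (sym Σ≡twice) Σ≡odd)
  where
  open ≡-Reasoning
  -- each ι-orbit {x , ι x} in P is counted once, at its smaller element
  first : Fin _ → ℤ
  first x = ⟦ P x ∧ does (toℕ x ℕ.<? toℕ (ι x)) ⟧
  exactly-one-smaller : ∀ x → ι x ≢ x →
    ⟦ does (toℕ x ℕ.<? toℕ (ι x)) ⟧ + ⟦ does (toℕ (ι x) ℕ.<? toℕ (ι (ι x))) ⟧ ≡ + 1
  exactly-one-smaller x ιx≢x rewrite ιι x with ℕ.<-cmp (toℕ x) (toℕ (ι x))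
  ... | tri< x<ιx _ ιx≮x = cong₂ (λ a b → ⟦ a ⟧ + ⟦ b ⟧) (dec-true (_ ℕ.<? _) x<ιx) (dec-false (_ ℕ.<? _) ιx≮x)
  ... | tri≈ _ x≡ιx _    = contradiction (toℕ-injective (sym x≡ιx)) ιx≢x
  ... | tri> x≮ιx _ ιx<x = cong₂ (λ a b → ⟦ a ⟧ + ⟦ b ⟧) (dec-false (_ ℕ.<? _) x≮ιx) (dec-true (_ ℕ.<? _) ιx<x)
  first-pair : ∀ x → first x + first (ι x) ≡ ⟦ P x ⟧
  first-pair x with P x in Px
  ... | false rewrite Pι x | Px = refl
  ... | true  rewrite Pι x | Px = exactly-one-smaller x (fixpoint-free x Px)
  Σ≡twice : sum (⟦_⟧ ∘ P) ≡ sum first + sum first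
  Σ≡twice = begin
    sum (⟦_⟧ ∘ P)                      ≡⟨ sum-cong-≗ (λ x → sym (first-pair x)) ⟩
    sum (λ x → first x + first (ι x))   ≡⟨ ∑-distrib-+ first (first ∘ ι) ⟩
    sum first + sum (first ∘ ι)        ≡⟨ cong (λ s → sum first + s) (sum-bijection first ι ι ιι ιι) ⟩
    sum first + sum first              ∎

±1∧orthogonal⇒isHadamard : ∀ {n} (H : Matrix n) → (∀ i k → IsSign (H i k)) →
                           (∀ i k → i ≢ k → sum (λ l → H i l * H k l) ≡ 0ℤ) → IsHadamard n H
±1∧orthogonal⇒isHadamard {n} H ±1 orthogonal = ±1 , λ i k → diagonal i k , off-diagonal i k
  where
  diagonal : ∀ i k → i ≡ k → sumℤ (λ l → H i l * H k l) ≡ + n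
  diagonal i .i refl = begin
    sumℤ (λ l → H i l * H i l) ≡⟨ sumℤ≗sum (λ l → H i l * H i l) ⟩
    sum (λ l → H i l * H i l)  ≡⟨ sum-cong-≗ (λ l → isSign-square (±1 i l)) ⟩
    sum {n} (λ _ → + 1)        ≡⟨ sum-ones n ⟩
    + n                        ∎
    where open ≡-Reasoning
  off-diagonal : ∀ i k → i ≢ k → sumℤ (λ l → H i l * H k l) ≡ 0ℤ
  off-diagonal i k i≢k = trans (sumℤ≗sum (λ l → H i l * H k l)) (orthogonal i k i≢k)

rescale : ∀ {n} → (Fin n → ℤ) → (Fin n → ℤ) → Matrix n → Matrix n
rescale r c H i l = r i * H i l * c l

rescale-isHadamard : ∀ {n} {r c : Fin n → ℤ} {H : Matrix n} → (∀ i → IsSign (r i)) → (∀ l → IsSign (c l)) →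
                     IsHadamard n H → IsHadamard n (rescale r c H)
rescale-isHadamard {n} {r} {c} {H} r±1 c±1 (H±1 , H-orthogonal) =
  ±1∧orthogonal⇒isHadamard (rescale r c H) (λ i l → isSign-* (isSign-* (r±1 i) (H±1 i l)) (c±1 l)) orthogonal
  where
  open ≡-Reasoning
  regroup : ∀ a b x y e → a * x * e * (b * y * e) ≡ a * b * (x * y * (e * e))
  regroup = solve-∀
  orthogonal : ∀ i k → i ≢ k → sum (λ l → rescale r c H i l * rescale r c H k l) ≡ 0ℤ
  orthogonal i k i≢k = begin
    sum (λ l → rescale r c H i l * rescale r c H k l)   ≡⟨ sum-cong-≗ (λ l → regroup (r i) (r k) (H i l) (H k l) (c l)) ⟩
    sum (λ l → r i * r k * (H i l * H k l * (c l * c l))) ≡⟨ sum-*ˡ (r i * r k) (λ l → H i l * H k l * (c l * c l)) ⟩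
    r i * r k * sum (λ l → H i l * H k l * (c l * c l))
      ≡⟨ cong (r i * r k *_) (sum-cong-≗ (λ l → trans (cong (H i l * H k l *_) (isSign-square (c±1 l))) (ℤ.*-identityʳ _))) ⟩
    r i * r k * sum (λ l → H i l * H k l)
      ≡⟨ cong (r i * r k *_) (trans (sym (sumℤ≗sum (λ l → H i l * H k l))) (proj₂ (H-orthogonal i k) i≢k)) ⟩
    r i * r k * 0ℤ                                      ≡⟨ ℤ.*-zeroʳ (r i * r k) ⟩
    0ℤ                                                  ∎

rowSum-rescale : ∀ {n} (r c : Fin n → ℤ) (H : Matrix n) i → rowSum (rescale r c H) i ≡ r i * sum (λ l → H i l * c l)
rowSum-rescale r c H i = begin
  rowSum (rescale r c H) i           ≡⟨ sumℤ≗sum (rescale r c H i) ⟩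
  sum (λ l → r i * H i l * c l)      ≡⟨ sum-cong-≗ (λ l → ℤ.*-assoc (r i) (H i l) (c l)) ⟩
  sum (λ l → r i * (H i l * c l))    ≡⟨ sum-*ˡ (r i) (λ l → H i l * c l) ⟩
  r i * sum (λ l → H i l * c l)      ∎
  where open ≡-Reasoning

module FiniteFieldProperties {q : ℕ} (F : FiniteField q) where

  open FiniteField F renaming (_+_ to _⊕_; _*_ to _⊗_; -_ to ⊖_)
  open IsCommutativeRing isCommutativeRing
    using (+-assoc; +-comm; +-identityˡ; +-identityʳ; -‿inverseˡ; -‿inverseʳ;
           *-assoc; *-comm; *-identityˡ; *-identityʳ; zeroˡ; zeroʳ; distribʳ)

  commutativeRing : CommutativeRing _ _
  commutativeRing = record { isCommutativeRing = isCommutativeRing }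

  open CommutativeRing commutativeRing using (+-abelianGroup; ring; *-commutativeSemigroup; commutativeSemiring)
  open import Algebra.Properties.AbelianGroup +-abelianGroup
    using (⁻¹-involutive; ε⁻¹≈ε; inverseˡ-unique; x∙y⁻¹≈ε⇒x≈y; identityʳ-unique)
  open import Algebra.Properties.Ring ring using (-1*x≈-x; -‿distribˡ-*)
  open import Algebra.Properties.CommutativeSemigroup *-commutativeSemigroup using (interchange; xy∙z≈y∙xz)
  open import Algebra.Solver.Ring.NaturalCoefficients.Default commutativeSemiring
    using (solve; _:+_; _:*_; _:=_)

  IsSquare : Fin q → Set
  IsSquare = IsSquareOrZero F

  square? : ∀ z → Dec (IsSquare z)
  square? z = any? (λ y → y ⊗ y ≟ z)

  zero-product : ∀ x y → x ⊗ y ≡ 0# → x ≡ 0# ⊎ y ≡ 0#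
  zero-product x y xy≡0 with x ≟ 0#
  ... | yes x≡0 = inj₁ x≡0
  ... | no  x≢0 = inj₂ (begin
    y              ≡⟨ *-identityˡ y ⟨
    1# ⊗ y         ≡⟨ cong (_⊗ y) (proj₂ (inverse x x≢0)) ⟨
    (x ⊗ x⁻¹) ⊗ y  ≡⟨ xy∙z≈y∙xz x x⁻¹ y ⟩
    x⁻¹ ⊗ (x ⊗ y)  ≡⟨ cong (x⁻¹ ⊗_) xy≡0 ⟩
    x⁻¹ ⊗ 0#       ≡⟨ zeroʳ x⁻¹ ⟩
    0#             ∎)
    where
    open ≡-Reasoning
    x⁻¹ : Fin q
    x⁻¹ = proj₁ (inverse x x≢0)

  ⊗-nonzero : ∀ {x y} → x ≢ 0# → y ≢ 0# → x ⊗ y ≢ 0#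
  ⊗-nonzero {x} {y} x≢0 y≢0 xy≡0 with zero-product x y xy≡0
  ... | inj₁ x≡0 = x≢0 x≡0
  ... | inj₂ y≡0 = y≢0 y≡0

  square-nonzero : ∀ {x} → x ≢ 0# → x ⊗ x ≢ 0#
  square-nonzero x≢0 = ⊗-nonzero x≢0 x≢0

  square-⊗ : ∀ {a b} → IsSquare a → IsSquare b → IsSquare (a ⊗ b)
  square-⊗ (u , u²≡a) (w , w²≡b) = u ⊗ w , trans (interchange u w u w) (cong₂ _⊗_ u²≡a w²≡b)

  nonsquare-⊗ : ∀ {a b} → a ≢ 0# → IsSquare a → ¬ IsSquare b → ¬ IsSquare (a ⊗ b)
  nonsquare-⊗ {a} {b} a≢0 (u , u²≡a) b∉□ (t , t²≡ab) = b∉□ (t ⊗ u⁻¹ , (begin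
    (t ⊗ u⁻¹) ⊗ (t ⊗ u⁻¹)          ≡⟨ interchange t u⁻¹ t u⁻¹ ⟩
    (t ⊗ t) ⊗ (u⁻¹ ⊗ u⁻¹)          ≡⟨ cong (_⊗ (u⁻¹ ⊗ u⁻¹)) (trans t²≡ab (cong (_⊗ b) (sym u²≡a))) ⟩
    ((u ⊗ u) ⊗ b) ⊗ (u⁻¹ ⊗ u⁻¹)    ≡⟨ solve 3 (λ u b v → ((u :* u) :* b) :* (v :* v) := ((u :* v) :* (u :* v)) :* b) refl u b u⁻¹ ⟩
    ((u ⊗ u⁻¹) ⊗ (u ⊗ u⁻¹)) ⊗ b    ≡⟨ cong (λ e → (e ⊗ e) ⊗ b) (proj₂ (inverse u u≢0)) ⟩
    (1# ⊗ 1#) ⊗ b                  ≡⟨ trans (cong (_⊗ b) (*-identityˡ 1#)) (*-identityˡ b) ⟩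
    b                              ∎))
    where
    open ≡-Reasoning
    u≢0 : u ≢ 0#
    u≢0 u≡0 = a≢0 (trans (sym u²≡a) (trans (cong (_⊗ u) u≡0) (zeroˡ u)))
    u⁻¹ : Fin q
    u⁻¹ = proj₁ (inverse u u≢0)

  ⊖-involutive : ∀ x → ⊖ (⊖ x) ≡ x
  ⊖-involutive = ⁻¹-involutive

  ⊖-square : ∀ y → ⊖ y ⊗ ⊖ y ≡ y ⊗ y
  ⊖-square y = begin
    ⊖ y ⊗ ⊖ y       ≡⟨ -‿distribˡ-* y (⊖ y) ⟨
    ⊖ (y ⊗ ⊖ y)     ≡⟨ cong ⊖_ (trans (*-comm y (⊖ y)) (sym (-‿distribˡ-* y y))) ⟩
    ⊖ (⊖ (y ⊗ y))   ≡⟨ ⊖-involutive (y ⊗ y) ⟩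
    y ⊗ y           ∎
    where open ≡-Reasoning


  inv : Fin q → Fin q
  inv x with x ≟ 0#
  ... | yes _   = 0#
  ... | no  x≢0 = proj₁ (inverse x x≢0)

  inv-0 : inv 0# ≡ 0#
  inv-0 with 0# ≟ 0#
  ... | yes _   = refl
  ... | no  0≢0 = contradiction refl 0≢0

  ⊗-inv : ∀ {x} → x ≢ 0# → x ⊗ inv x ≡ 1#
  ⊗-inv {x} x≢0 with x ≟ 0#
  ... | yes x≡0  = contradiction x≡0 x≢0
  ... | no  x≢0′ = proj₂ (inverse x x≢0′)

  inverse-unique : ∀ {x y z} → x ⊗ y ≡ 1# → x ⊗ z ≡ 1# → y ≡ z
  inverse-unique {x} {y} {z} xy≡1 xz≡1 = begin
    y              ≡⟨ *-identityˡ y ⟨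
    1# ⊗ y         ≡⟨ cong (_⊗ y) xz≡1 ⟨
    (x ⊗ z) ⊗ y    ≡⟨ xy∙z≈y∙xz x z y ⟩
    z ⊗ (x ⊗ y)    ≡⟨ cong (z ⊗_) xy≡1 ⟩
    z ⊗ 1#         ≡⟨ *-identityʳ z ⟩
    z              ∎
    where open ≡-Reasoning

  inv-nonzero : ∀ {x} → x ≢ 0# → inv x ≢ 0#
  inv-nonzero {x} x≢0 inv≡0 = 0≢1 (trans (sym (zeroʳ x)) (trans (cong (x ⊗_) (sym inv≡0)) (⊗-inv x≢0)))

  inv-involutive : ∀ x → inv (inv x) ≡ x
  inv-involutive x = by-cases (x ≟ 0#)
    where
    by-cases : Dec (x ≡ 0#) → inv (inv x) ≡ x
    by-cases (yes refl) = trans (cong inv inv-0) inv-0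
    by-cases (no  x≢0)  = inverse-unique (⊗-inv (inv-nonzero x≢0)) (trans (*-comm (inv x) x) (⊗-inv x≢0))

  sum-affine : ∀ (g : Fin q → ℤ) {c} d → c ≢ 0# → sum (λ x → g (c ⊗ x ⊕ d)) ≡ sum g
  sum-affine g {c} d c≢0 = sum-bijection g (λ x → c ⊗ x ⊕ d) (λ y → inv c ⊗ (y ⊕ ⊖ d)) left right
    where
    open ≡-Reasoning
    left : ∀ y → c ⊗ (inv c ⊗ (y ⊕ ⊖ d)) ⊕ d ≡ y
    left y = begin
      c ⊗ (inv c ⊗ (y ⊕ ⊖ d)) ⊕ d  ≡⟨ cong (_⊕ d) (sym (*-assoc c (inv c) _)) ⟩
      (c ⊗ inv c) ⊗ (y ⊕ ⊖ d) ⊕ d  ≡⟨ cong (λ e → e ⊗ (y ⊕ ⊖ d) ⊕ d) (⊗-inv c≢0) ⟩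
      1# ⊗ (y ⊕ ⊖ d) ⊕ d           ≡⟨ cong (_⊕ d) (*-identityˡ _) ⟩
      (y ⊕ ⊖ d) ⊕ d                ≡⟨ +-assoc y (⊖ d) d ⟩
      y ⊕ (⊖ d ⊕ d)                ≡⟨ cong (y ⊕_) (-‿inverseˡ d) ⟩
      y ⊕ 0#                       ≡⟨ +-identityʳ y ⟩
      y                            ∎
    right : ∀ x → inv c ⊗ ((c ⊗ x ⊕ d) ⊕ ⊖ d) ≡ x
    right x = begin
      inv c ⊗ ((c ⊗ x ⊕ d) ⊕ ⊖ d)  ≡⟨ cong (inv c ⊗_) (trans (+-assoc _ d (⊖ d)) (cong (c ⊗ x ⊕_) (-‿inverseʳ d))) ⟩
      inv c ⊗ (c ⊗ x ⊕ 0#)         ≡⟨ cong (inv c ⊗_) (+-identityʳ _) ⟩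
      inv c ⊗ (c ⊗ x)              ≡⟨ sym (*-assoc _ c x) ⟩
      (inv c ⊗ c) ⊗ x              ≡⟨ cong (_⊗ x) (trans (*-comm _ c) (⊗-inv c≢0)) ⟩
      1# ⊗ x                       ≡⟨ *-identityˡ x ⟩
      x                            ∎

  1≢0 : 1# ≢ 0#
  1≢0 = 0≢1 ∘ sym

  sum-shift : ∀ (g : Fin q → ℤ) d → sum (λ x → g (x ⊕ d)) ≡ sum g
  sum-shift g d = trans (sum-cong-≗ (λ x → cong (λ y → g (y ⊕ d)) (sym (*-identityˡ x)))) (sum-affine g d 1≢0)

  sum-scale : ∀ (g : Fin q → ℤ) {c} → c ≢ 0# → sum (λ x → g (c ⊗ x)) ≡ sum g
  sum-scale g {c} c≢0 = trans (sum-cong-≗ (λ x → cong g (sym (+-identityʳ (c ⊗ x))))) (sum-affine g 0# c≢0)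

  sum-inv : ∀ (g : Fin q → ℤ) → sum (g ∘ inv) ≡ sum g
  sum-inv g = sum-bijection g inv inv inv-involutive inv-involutive

  squareBlock-∋ : ∀ a z → lookup (squareBlock F a) z ≡ does (square? (z ⊕ ⊖ a))
  squareBlock-∋ a z = trans (lookup∘tabulate _ z) (does-⇔ (mk⇔ to from) (any? (λ y → y ⊗ y ⊕ a ≟ z)) (square? (z ⊕ ⊖ a)))
    where
    open ≡-Reasoning
    to : (∃ λ y → y ⊗ y ⊕ a ≡ z) → IsSquare (z ⊕ ⊖ a)
    to (y , y²+a≡z) = y , (begin
      y ⊗ y                 ≡⟨ +-identityʳ _ ⟨
      y ⊗ y ⊕ 0#            ≡⟨ cong (y ⊗ y ⊕_) (-‿inverseʳ a) ⟨
      y ⊗ y ⊕ (a ⊕ ⊖ a)     ≡⟨ +-assoc _ a (⊖ a) ⟨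
      (y ⊗ y ⊕ a) ⊕ ⊖ a     ≡⟨ cong (_⊕ ⊖ a) y²+a≡z ⟩
      z ⊕ ⊖ a               ∎)
    from : IsSquare (z ⊕ ⊖ a) → ∃ λ y → y ⊗ y ⊕ a ≡ z
    from (y , y²≡z-a) = y , (begin
      y ⊗ y ⊕ a             ≡⟨ cong (_⊕ a) y²≡z-a ⟩
      (z ⊕ ⊖ a) ⊕ a         ≡⟨ +-assoc z (⊖ a) a ⟩
      z ⊕ (⊖ a ⊕ a)         ≡⟨ cong (z ⊕_) (-‿inverseˡ a) ⟩
      z ⊕ 0#                ≡⟨ +-identityʳ z ⟩
      z                     ∎)

  square-roots : ∀ {y z} → y ⊗ y ≡ z ⊗ z → y ≡ z ⊎ y ≡ ⊖ z
  square-roots {y} {z} y²≡z² with zero-product (y ⊕ ⊖ z) (y ⊕ z) difference-of-squares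
    where
    open ≡-Reasoning
    cancels : ∀ a w → a ⊗ w ⊕ ⊖ a ⊗ w ≡ 0#
    cancels a w = trans (sym (distribʳ w a (⊖ a))) (trans (cong (_⊗ w) (-‿inverseʳ a)) (zeroˡ w))
    difference-of-squares : (y ⊕ ⊖ z) ⊗ (y ⊕ z) ≡ 0#
    difference-of-squares = begin
      (y ⊕ ⊖ z) ⊗ (y ⊕ z)
        ≡⟨ solve 3 (λ y n z → (y :+ n) :* (y :+ z) := (y :* y :+ n :* z) :+ (y :* z :+ n :* y)) refl y (⊖ z) z ⟩
      (y ⊗ y ⊕ ⊖ z ⊗ z) ⊕ (y ⊗ z ⊕ ⊖ z ⊗ y)  ≡⟨ cong₂ (λ a b → (a ⊕ ⊖ z ⊗ z) ⊕ (b ⊕ ⊖ z ⊗ y)) y²≡z² (*-comm y z) ⟩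
      (z ⊗ z ⊕ ⊖ z ⊗ z) ⊕ (z ⊗ y ⊕ ⊖ z ⊗ y)  ≡⟨ cong₂ _⊕_ (cancels z z) (cancels z y) ⟩
      0# ⊕ 0#                                ≡⟨ +-identityʳ 0# ⟩
      0#                                     ∎
  ... | inj₁ y-z≡0 = inj₁ (x∙y⁻¹≈ε⇒x≈y y z y-z≡0)
  ... | inj₂ y+z≡0 = inj₂ (inverseˡ-unique y z y+z≡0)

  0-square : IsSquare 0#
  0-square = 0# , zeroˡ 0#

  nonsquare-nonzero : ∀ {z} → ¬ IsSquare z → z ≢ 0#
  nonsquare-nonzero z∉□ refl = z∉□ 0-square

  σ : Fin q → ℤ
  σ z = signed (does (square? z))

  δ₀ : Fin q → ℤ
  δ₀ z = ⟦ does (z ≟ 0#) ⟧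

  sum-δ₀ : sum δ₀ ≡ + 1
  sum-δ₀ = sum-indicator-unique _ 0# (dec-true (0# ≟ 0#) refl) (λ x → does⇒ (x ≟ 0#))

  χ : Fin q → ℤ
  χ z = σ z - δ₀ z

  σ≡χ+δ₀ : ∀ z → σ z ≡ χ z + δ₀ z
  σ≡χ+δ₀ z = lemma (σ z) (δ₀ z)
    where
    lemma : ∀ a b → a ≡ a - b + b
    lemma = solve-∀

  χ-0 : χ 0# ≡ 0ℤ
  χ-0 rewrite dec-true (square? 0#) 0-square | dec-true (0# ≟ 0#) refl = refl

  χ-square : ∀ {z} → z ≢ 0# → IsSquare z → χ z ≡ + 1
  χ-square {z} z≢0 z∈□ rewrite dec-true (square? z) z∈□ | dec-false (z ≟ 0#) z≢0 = refl

  χ-nonsquare : ∀ {z} → ¬ IsSquare z → χ z ≡ - + 1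
  χ-nonsquare {z} z∉□ rewrite dec-false (square? z) z∉□ | dec-false (z ≟ 0#) (nonsquare-nonzero z∉□) = refl

  χ≤1 : ∀ z → χ z ≤ + 1
  χ≤1 z with square? z | z ≟ 0#
  ... | yes _ | yes _ = ℤ.+≤+ ℕ.z≤n
  ... | yes _ | no  _ = ℤ.≤-refl
  ... | no  _ | yes _ = ℤ.-≤+
  ... | no  _ | no  _ = ℤ.-≤+

  χ≡1⇒square : ∀ {z} → χ z ≡ + 1 → IsSquare z
  χ≡1⇒square {z} χz≡1 with square? z | z ≟ 0#
  ... | yes z∈□ | _     = z∈□
  ... | no  _   | yes _ = contradiction χz≡1 λ ()
  ... | no  _   | no  _ = contradiction χz≡1 λ ()

  χ-1 : χ 1# ≡ + 1
  χ-1 = χ-square 1≢0 (1# , *-identityˡ 1#)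

  χ²≡1 : ∀ {x} → x ≢ 0# → χ x * χ x ≡ + 1
  χ²≡1 {x} x≢0 = by-cases (square? x)
    where
    by-cases : Dec (IsSquare x) → χ x * χ x ≡ + 1
    by-cases (yes x∈□) = cong (λ c → c * c) (χ-square x≢0 x∈□)
    by-cases (no  x∉□) = cong (λ c → c * c) (χ-nonsquare x∉□)

  module OddOrder {h : ℕ} (q≡2h+1 : q ≡ suc (2 ℕ.* h)) where

    -- otherwise x ↦ x ⊕ 1# would pair off the q elements
    1⊕1≢0 : 1# ⊕ 1# ≢ 0#
    1⊕1≢0 1⊕1≡0 = involution-count≢odd (_⊕ 1#) shift-involutive (λ _ → true) (λ _ → refl) no-fixpoint h
                     (trans (sum-ones q) (cong +_ q≡2h+1))
      where
      shift-involutive : ∀ x → (x ⊕ 1#) ⊕ 1# ≡ x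
      shift-involutive x = trans (+-assoc x 1# 1#) (trans (cong (x ⊕_) 1⊕1≡0) (+-identityʳ x))
      no-fixpoint : ∀ x → true ≡ true → x ⊕ 1# ≢ x
      no-fixpoint x _ x⊕1≡x = 1≢0 (identityʳ-unique x 1# x⊕1≡x)

    ⊖-no-fixpoint : ∀ {x} → x ≢ 0# → ⊖ x ≢ x
    ⊖-no-fixpoint {x} x≢0 ⊖x≡x with zero-product (1# ⊕ 1#) x (begin
      (1# ⊕ 1#) ⊗ x    ≡⟨ distribʳ x 1# 1# ⟩
      1# ⊗ x ⊕ 1# ⊗ x  ≡⟨ cong₂ _⊕_ (*-identityˡ x) (*-identityˡ x) ⟩
      x ⊕ x            ≡⟨ cong (x ⊕_) ⊖x≡x ⟨
      x ⊕ ⊖ x          ≡⟨ -‿inverseʳ x ⟩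
      0#               ∎)
      where open ≡-Reasoning
    ... | inj₁ 1⊕1≡0 = 1⊕1≢0 1⊕1≡0
    ... | inj₂ x≡0   = x≢0 x≡0

    roots-of-nonsquare : ∀ {s} → ¬ IsSquare s → sum (λ y → ⟦ does (y ⊗ y ≟ s) ⟧) ≡ + 1 + χ s
    roots-of-nonsquare {s} s∉□ = begin
      sum (λ y → ⟦ does (y ⊗ y ≟ s) ⟧) ≡⟨ sum-cong-≗ (λ y → cong ⟦_⟧ (dec-false (y ⊗ y ≟ s) (λ y²≡s → s∉□ (y , y²≡s)))) ⟩
      sum {q} (λ _ → 0ℤ)               ≡⟨ sum-replicate-zero q ⟩
      0ℤ                               ≡⟨ cong (λ c → + 1 + c) (χ-nonsquare s∉□) ⟨
      + 1 + χ s                        ∎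
      where open ≡-Reasoning

    roots-of-square : ∀ a → sum (λ y → ⟦ does (y ⊗ y ≟ a ⊗ a) ⟧) ≡ + 1 + χ (a ⊗ a)
    roots-of-square a with a ≟ 0#
    ... | yes refl = begin
      sum (λ y → ⟦ does (y ⊗ y ≟ 0# ⊗ 0#) ⟧) ≡⟨ sum-indicator-unique _ 0# (dec-true (0# ⊗ 0# ≟ 0# ⊗ 0#) refl) only-zero ⟩
      + 1                                     ≡⟨ cong (λ c → + 1 + c) (trans (cong χ (zeroˡ 0#)) χ-0) ⟨
      + 1 + χ (0# ⊗ 0#)                       ∎
      where
      open ≡-Reasoning
      only-zero : ∀ y → does (y ⊗ y ≟ 0# ⊗ 0#) ≡ true → y ≡ 0#
      only-zero y y²≡0 with zero-product y y (trans (does⇒ (y ⊗ y ≟ 0# ⊗ 0#) y²≡0) (zeroˡ 0#))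
      ... | inj₁ y≡0 = y≡0
      ... | inj₂ y≡0 = y≡0
    ... | no a≢0 = begin
      sum (λ y → ⟦ does (y ⊗ y ≟ a ⊗ a) ⟧)                         ≡⟨ sum-cong-≗ two-roots ⟩
      sum (λ y → ⟦ does (y ≟ a) ⟧ + ⟦ does (y ≟ ⊖ a) ⟧)             ≡⟨ ∑-distrib-+ (λ y → ⟦ does (y ≟ a) ⟧) (λ y → ⟦ does (y ≟ ⊖ a) ⟧) ⟩
      sum (λ y → ⟦ does (y ≟ a) ⟧) + sum (λ y → ⟦ does (y ≟ ⊖ a) ⟧) ≡⟨ cong₂ _+_ (sum-indicator-≟ a) (sum-indicator-≟ (⊖ a)) ⟩
      + 1 + + 1                                                   ≡⟨ cong (λ c → + 1 + c) (χ-square (square-nonzero a≢0) (a , refl)) ⟨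
      + 1 + χ (a ⊗ a)                                             ∎
      where
      open ≡-Reasoning
      sum-indicator-≟ : ∀ b → sum (λ y → ⟦ does (y ≟ b) ⟧) ≡ + 1
      sum-indicator-≟ b = sum-indicator-unique _ b (dec-true (b ≟ b) refl) (λ y → does⇒ (y ≟ b))
      two-roots : ∀ y → ⟦ does (y ⊗ y ≟ a ⊗ a) ⟧ ≡ ⟦ does (y ≟ a) ⟧ + ⟦ does (y ≟ ⊖ a) ⟧
      two-roots y with y ≟ a | y ≟ ⊖ a
      ... | yes refl | yes y≡⊖y = contradiction (sym y≡⊖y) (⊖-no-fixpoint a≢0)
      ... | yes refl | no  _    = cong ⟦_⟧ (dec-true (y ⊗ y ≟ y ⊗ y) refl)
      ... | no  _    | yes refl = cong ⟦_⟧ (dec-true (⊖ a ⊗ ⊖ a ≟ a ⊗ a) (⊖-square a))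
      ... | no  y≢a  | no  y≢⊖a = cong ⟦_⟧ (dec-false (y ⊗ y ≟ a ⊗ a) λ y²≡a² → [ y≢a , y≢⊖a ]′ (square-roots y²≡a²))

    roots-count : ∀ s → sum (λ y → ⟦ does (y ⊗ y ≟ s) ⟧) ≡ + 1 + χ s
    roots-count s = by-cases (square? s)
      where
      by-cases : Dec (IsSquare s) → sum (λ y → ⟦ does (y ⊗ y ≟ s) ⟧) ≡ + 1 + χ s
      by-cases (no  s∉□)       = roots-of-nonsquare s∉□
      by-cases (yes (a , a²≡s)) = subst (λ t → sum (λ y → ⟦ does (y ⊗ y ≟ t) ⟧) ≡ + 1 + χ t) a²≡s (roots-of-square a)

    -- count the pairs (y , s) with y ⊗ y ≡ s in both orders
    sum-χ : sum χ ≡ 0ℤ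
    sum-χ = +-cancelˡ (+ q) (sum χ) 0ℤ (begin
      + q + sum χ                                         ≡⟨ cong (_+ sum χ) (sum-ones q) ⟨
      sum {q} (λ _ → + 1) + sum χ                         ≡⟨ ∑-distrib-+ (λ _ → + 1) χ ⟨
      sum (λ s → + 1 + χ s)                               ≡⟨ sum-cong-≗ roots-count ⟨
      sum (λ s → sum (λ y → ⟦ does (y ⊗ y ≟ s) ⟧))         ≡⟨ ∑-comm (λ s y → ⟦ does (y ⊗ y ≟ s) ⟧) ⟩
      sum (λ y → sum (λ s → ⟦ does (y ⊗ y ≟ s) ⟧))         ≡⟨ sum-cong-≗ one-square ⟩
      sum {q} (λ _ → + 1)                                 ≡⟨ sum-ones q ⟩
      + q                                                 ≡⟨ ℤ.+-identityʳ (+ q) ⟨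
      + q + 0ℤ                                            ∎)
      where
      open ≡-Reasoning
      one-square : ∀ y → sum (λ s → ⟦ does (y ⊗ y ≟ s) ⟧) ≡ + 1
      one-square y = sum-indicator-unique _ (y ⊗ y) (dec-true (y ⊗ y ≟ y ⊗ y) refl)
                                          (λ s y²≡s → sym (does⇒ (y ⊗ y ≟ s) y²≡s))

    -- multiplication by a nonsquare permutes the field, so Σ χ (a ⊗ z) = 0 = Σ (- χ z);
    -- since χ (a ⊗ z) ≤ - χ z termwise, equality holds termwise
    nonsquare-⊗-nonsquare : ∀ {a b} → ¬ IsSquare a → ¬ IsSquare b → IsSquare (a ⊗ b)
    nonsquare-⊗-nonsquare {a} {b} a∉□ b∉□ = χ≡1⇒square (begin
      χ (a ⊗ b)   ≡⟨ ≤∧sum-≡⇒≗ bound sums-equal b ⟩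
      - χ b       ≡⟨ cong -_ (χ-nonsquare b∉□) ⟩
      + 1         ∎)
      where
      open ≡-Reasoning
      a≢0 : a ≢ 0#
      a≢0 = nonsquare-nonzero a∉□
      bound : ∀ z → χ (a ⊗ z) ≤ - χ z
      bound z = by-cases (z ≟ 0#) (square? z)
        where
        by-cases : Dec (z ≡ 0#) → Dec (IsSquare z) → χ (a ⊗ z) ≤ - χ z
        by-cases (yes refl) _ = ℤ.≤-reflexive (trans (cong χ (zeroʳ a)) (trans χ-0 (cong -_ (sym χ-0))))
        by-cases (no z≢0) (yes z∈□) = ℤ.≤-reflexive (begin
          χ (a ⊗ z)   ≡⟨ χ-nonsquare (λ az∈□ → nonsquare-⊗ z≢0 z∈□ a∉□ (subst IsSquare (*-comm a z) az∈□)) ⟩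
          - + 1       ≡⟨ cong -_ (χ-square z≢0 z∈□) ⟨
          - χ z       ∎)
        by-cases (no _) (no z∉□) = subst (χ (a ⊗ z) ≤_) (cong -_ (sym (χ-nonsquare z∉□))) (χ≤1 (a ⊗ z))
      sums-equal : sum (λ z → χ (a ⊗ z)) ≡ sum (λ z → - χ z)
      sums-equal = begin
        sum (λ z → χ (a ⊗ z)) ≡⟨ trans (sum-scale χ a≢0) sum-χ ⟩
        0ℤ                    ≡⟨ cong -_ sum-χ ⟨
        - sum χ               ≡⟨ sum-neg χ ⟨
        sum (λ z → - χ z)     ∎

    χ-⊗ : ∀ a b → χ (a ⊗ b) ≡ χ a * χ b
    χ-⊗ a b = by-cases (a ≟ 0#) (b ≟ 0#) (square? a) (square? b)
      where
      open ≡-Reasoning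
      by-cases : Dec (a ≡ 0#) → Dec (b ≡ 0#) → Dec (IsSquare a) → Dec (IsSquare b) → χ (a ⊗ b) ≡ χ a * χ b
      by-cases (yes refl) _ _ _ = begin
        χ (0# ⊗ b)  ≡⟨ trans (cong χ (zeroˡ b)) χ-0 ⟩
        0ℤ          ≡⟨ ℤ.*-zeroˡ (χ b) ⟨
        0ℤ * χ b    ≡⟨ cong (_* χ b) χ-0 ⟨
        χ 0# * χ b  ∎
      by-cases (no _) (yes refl) _ _ = begin
        χ (a ⊗ 0#)  ≡⟨ trans (cong χ (zeroʳ a)) χ-0 ⟩
        0ℤ          ≡⟨ ℤ.*-zeroʳ (χ a) ⟨
        χ a * 0ℤ    ≡⟨ cong (χ a *_) χ-0 ⟨
        χ a * χ 0#  ∎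
      by-cases (no a≢0) (no b≢0) (yes a∈□) (yes b∈□) =
        trans (χ-square (⊗-nonzero a≢0 b≢0) (square-⊗ a∈□ b∈□)) (cong₂ _*_ (sym (χ-square a≢0 a∈□)) (sym (χ-square b≢0 b∈□)))
      by-cases (no a≢0) (no _) (yes a∈□) (no b∉□) =
        trans (χ-nonsquare (nonsquare-⊗ a≢0 a∈□ b∉□)) (cong₂ _*_ (sym (χ-square a≢0 a∈□)) (sym (χ-nonsquare b∉□)))
      by-cases (no _) (no b≢0) (no a∉□) (yes b∈□) =
        trans (χ-nonsquare (λ ab∈□ → nonsquare-⊗ b≢0 b∈□ a∉□ (subst IsSquare (*-comm a b) ab∈□)))
              (cong₂ _*_ (sym (χ-nonsquare a∉□)) (sym (χ-square b≢0 b∈□)))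
      by-cases (no a≢0) (no b≢0) (no a∉□) (no b∉□) =
        trans (χ-square (⊗-nonzero a≢0 b≢0) (nonsquare-⊗-nonsquare a∉□ b∉□)) (cong₂ _*_ (sym (χ-nonsquare a∉□)) (sym (χ-nonsquare b∉□)))

    -- x ⊕ a = x ⊗ (a ⊗ x⁻¹ ⊕ 1#) for x ≢ 0#, and x ↦ a ⊗ x⁻¹ ⊕ 1# is a bijection (the total inv sends 0# to 0#)
    jacobsthal : ∀ {a} → a ≢ 0# → sum (λ x → χ x * χ (x ⊕ a)) ≡ - + 1
    jacobsthal {a} a≢0 = begin
      sum (λ x → χ x * χ (x ⊕ a))                                ≡⟨ sum-cong-≗ termwise ⟩
      sum (λ x → χ (a ⊗ inv x ⊕ 1#) - δ₀ x)                      ≡⟨ sum-- (λ x → χ (a ⊗ inv x ⊕ 1#)) δ₀ ⟩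
      sum (λ x → χ (a ⊗ inv x ⊕ 1#)) - sum δ₀                    ≡⟨ cong₂ _-_ (sum-inv (λ x → χ (a ⊗ x ⊕ 1#))) sum-δ₀ ⟩
      sum (λ x → χ (a ⊗ x ⊕ 1#)) - + 1                           ≡⟨ cong (_- + 1) (trans (sum-affine χ 1# a≢0) sum-χ) ⟩
      - + 1                                                      ∎
      where
      open ≡-Reasoning
      termwise : ∀ x → χ x * χ (x ⊕ a) ≡ χ (a ⊗ inv x ⊕ 1#) - δ₀ x
      termwise x = by-cases (x ≟ 0#)
        where
        by-cases : Dec (x ≡ 0#) → χ x * χ (x ⊕ a) ≡ χ (a ⊗ inv x ⊕ 1#) - δ₀ x
        by-cases (yes refl) = begin
          χ 0# * χ (0# ⊕ a)               ≡⟨ cong (_* χ (0# ⊕ a)) χ-0 ⟩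
          0ℤ                              ≡⟨ ℤ.+-inverseʳ (+ 1) ⟨
          + 1 - + 1                       ≡⟨ cong₂ _-_ (trans (cong (λ y → χ (a ⊗ y ⊕ 1#)) inv-0)
                                                               (trans (cong (λ y → χ (y ⊕ 1#)) (zeroʳ a))
                                                               (trans (cong χ (+-identityˡ 1#)) χ-1)))
                                                       (cong ⟦_⟧ (dec-true (0# ≟ 0#) refl)) ⟨
          χ (a ⊗ inv 0# ⊕ 1#) - δ₀ 0#     ∎
        by-cases (no x≢0) = begin
          χ x * χ (x ⊕ a)                 ≡⟨ cong (λ y → χ x * χ y) x⊕a≡x⊗[a⊗x⁻¹⊕1] ⟩
          χ x * χ (x ⊗ (a ⊗ inv x ⊕ 1#))  ≡⟨ cong (χ x *_) (χ-⊗ x _) ⟩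
          χ x * (χ x * χ (a ⊗ inv x ⊕ 1#)) ≡⟨ ℤ.*-assoc (χ x) (χ x) _ ⟨
          χ x * χ x * χ (a ⊗ inv x ⊕ 1#)  ≡⟨ cong (_* χ (a ⊗ inv x ⊕ 1#)) (χ²≡1 x≢0) ⟩
          + 1 * χ (a ⊗ inv x ⊕ 1#)        ≡⟨ ℤ.*-identityˡ _ ⟩
          χ (a ⊗ inv x ⊕ 1#)              ≡⟨ ℤ.+-identityʳ _ ⟨
          χ (a ⊗ inv x ⊕ 1#) - 0ℤ         ≡⟨ cong (λ b → χ (a ⊗ inv x ⊕ 1#) - ⟦ b ⟧) (dec-false (x ≟ 0#) x≢0) ⟨
          χ (a ⊗ inv x ⊕ 1#) - δ₀ x       ∎
          where
          x⊕a≡x⊗[a⊗x⁻¹⊕1] : x ⊕ a ≡ x ⊗ (a ⊗ inv x ⊕ 1#)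
          x⊕a≡x⊗[a⊗x⁻¹⊕1] = sym (begin
            x ⊗ (a ⊗ inv x ⊕ 1#)       ≡⟨ solve 4 (λ x a i o → x :* (a :* i :+ o) := a :* (x :* i) :+ x :* o) refl x a (inv x) 1# ⟩
            a ⊗ (x ⊗ inv x) ⊕ x ⊗ 1#   ≡⟨ cong₂ (λ e f → a ⊗ e ⊕ f) (⊗-inv x≢0) (*-identityʳ x) ⟩
            a ⊗ 1# ⊕ x                 ≡⟨ cong (_⊕ x) (*-identityʳ a) ⟩
            a ⊕ x                      ≡⟨ +-comm a x ⟩
            x ⊕ a                      ∎)

  module OrderThreeModFour {k : ℕ} (q≡4k+3 : q ≡ 4 ℕ.* k ℕ.+ 3) where

    q≡1+2[1+2k] : q ≡ suc (2 ℕ.* suc (2 ℕ.* k))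
    q≡1+2[1+2k] = trans q≡4k+3 (arithmetic k)
      where
      arithmetic : ∀ k → 4 ℕ.* k ℕ.+ 3 ≡ suc (2 ℕ.* suc (2 ℕ.* k))
      arithmetic = ℕ-solve-∀

    open OddOrder {suc (2 ℕ.* k)} q≡1+2[1+2k]

    -- otherwise negation would pair off the (q - 1) / 2 = 2k + 1 nonzero squares
    ⊖1-nonsquare : ¬ IsSquare (⊖ 1#)
    ⊖1-nonsquare (i , i²≡⊖1) = involution-count≢odd ⊖_ ⊖-involutive P P-⊖ no-fixpoint k (double-injective (begin
      sum (⟦_⟧ ∘ P) + sum (⟦_⟧ ∘ P)                     ≡⟨ ∑-distrib-+ (⟦_⟧ ∘ P) (⟦_⟧ ∘ P) ⟨
      sum (λ s → ⟦ P s ⟧ + ⟦ P s ⟧)                     ≡⟨ sum-cong-≗ twice-P ⟩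
      sum (λ s → + 1 + χ s - δ₀ s)                      ≡⟨ sum-- (λ s → + 1 + χ s) δ₀ ⟩
      sum (λ s → + 1 + χ s) - sum δ₀                    ≡⟨ cong₂ _-_ (∑-distrib-+ (λ _ → + 1) χ) sum-δ₀ ⟩
      sum {q} (λ _ → + 1) + sum χ - + 1                 ≡⟨ cong₂ (λ a b → a + b - + 1) (sum-ones q) sum-χ ⟩
      + q + 0ℤ - + 1                                    ≡⟨ cong (λ n → + n + 0ℤ - + 1) (trans q≡4k+3 (4k+3≡1+[1+2k]+[1+2k] k)) ⟩
      + suc (suc (2 ℕ.* k) ℕ.+ suc (2 ℕ.* k)) + 0ℤ - + 1 ≡⟨ cong (_- + 1) (ℤ.+-identityʳ (+ suc (suc (2 ℕ.* k) ℕ.+ suc (2 ℕ.* k)))) ⟩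
      + suc (2 ℕ.* k) + + suc (2 ℕ.* k)                 ∎))
      where
      open ≡-Reasoning
      P : Fin q → Bool
      P s = not (does (s ≟ 0#)) ∧ does (square? s)
      i-rotates : ∀ y → (i ⊗ y) ⊗ (i ⊗ y) ≡ ⊖ (y ⊗ y)
      i-rotates y = trans (interchange i y i y) (trans (cong (_⊗ (y ⊗ y)) i²≡⊖1) (-1*x≈-x (y ⊗ y)))
      square-⊖ : ∀ s → IsSquare (⊖ s) ⇔ IsSquare s
      square-⊖ s = mk⇔ (λ (y , y²≡⊖s) → i ⊗ y , trans (i-rotates y) (trans (cong ⊖_ y²≡⊖s) (⊖-involutive s)))
                       (λ (y , y²≡s) → i ⊗ y , trans (i-rotates y) (cong ⊖_ y²≡s))
      zero-⊖ : ∀ s → (⊖ s ≡ 0#) ⇔ (s ≡ 0#)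
      zero-⊖ s = mk⇔ (λ ⊖s≡0 → trans (sym (⊖-involutive s)) (trans (cong ⊖_ ⊖s≡0) ε⁻¹≈ε))
                     (λ s≡0 → trans (cong ⊖_ s≡0) ε⁻¹≈ε)
      P-⊖ : ∀ s → P (⊖ s) ≡ P s
      P-⊖ s = cong₂ (λ a b → not a ∧ b) (does-⇔ (zero-⊖ s) (⊖ s ≟ 0#) (s ≟ 0#)) (does-⇔ (square-⊖ s) (square? (⊖ s)) (square? s))
      no-fixpoint : ∀ s → P s ≡ true → ⊖ s ≢ s
      no-fixpoint s Ps with s ≟ 0#
      ... | no s≢0 = ⊖-no-fixpoint s≢0
      twice-P : ∀ s → ⟦ P s ⟧ + ⟦ P s ⟧ ≡ + 1 + χ s - δ₀ s
      twice-P s with s ≟ 0# | square? s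
      ... | yes _   | yes _   = refl
      ... | yes s≡0 | no  s∉□ = contradiction (subst IsSquare (sym s≡0) 0-square) s∉□
      ... | no  _   | yes _   = refl
      ... | no  _   | no  _   = refl
      4k+3≡1+[1+2k]+[1+2k] : ∀ k → 4 ℕ.* k ℕ.+ 3 ≡ suc (suc (2 ℕ.* k) ℕ.+ suc (2 ℕ.* k))
      4k+3≡1+[1+2k]+[1+2k] = ℕ-solve-∀

    χ-⊖ : ∀ d → χ (⊖ d) ≡ - χ d
    χ-⊖ d = begin
      χ (⊖ d)         ≡⟨ cong χ (-1*x≈-x d) ⟨
      χ (⊖ 1# ⊗ d)    ≡⟨ χ-⊗ (⊖ 1#) d ⟩
      χ (⊖ 1#) * χ d  ≡⟨ cong (_* χ d) (χ-nonsquare ⊖1-nonsquare) ⟩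
      - + 1 * χ d     ≡⟨ ℤ.-1*i≡-i (χ d) ⟩
      - χ d           ∎
      where open ≡-Reasoning

    sum-σ : sum σ ≡ + 1
    sum-σ = begin
      sum σ                   ≡⟨ sum-cong-≗ σ≡χ+δ₀ ⟩
      sum (λ z → χ z + δ₀ z)  ≡⟨ ∑-distrib-+ χ δ₀ ⟩
      sum χ + sum δ₀          ≡⟨ cong₂ _+_ sum-χ sum-δ₀ ⟩
      + 1                     ∎
      where open ≡-Reasoning

    -- that is, the nonzero squares form a difference set
    σ-autocorrelation : ∀ {d} → d ≢ 0# → sum (λ w → σ w * σ (w ⊕ d)) ≡ - + 1
    σ-autocorrelation {d} d≢0 = begin
      sum (λ w → σ w * σ (w ⊕ d))                                  ≡⟨ sum-cong-≗ (λ w → cong₂ _*_ (σ≡χ+δ₀ w) (σ≡χ+δ₀ (w ⊕ d))) ⟩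
      sum (λ w → (χ w + δ₀ w) * (χ (w ⊕ d) + δ₀ (w ⊕ d)))          ≡⟨ sum-cong-≗ (λ w → expand (χ w) (δ₀ w) (χ (w ⊕ d)) (δ₀ (w ⊕ d))) ⟩
      sum (λ w → f₁ w + f₂ w + (f₃ w + f₄ w))                       ≡⟨ ∑-distrib-+ (λ w → f₁ w + f₂ w) (λ w → f₃ w + f₄ w) ⟩
      sum (λ w → f₁ w + f₂ w) + sum (λ w → f₃ w + f₄ w)            ≡⟨ cong₂ _+_ (∑-distrib-+ f₁ f₂) (∑-distrib-+ f₃ f₄) ⟩
      sum f₁ + sum f₂ + (sum f₃ + sum f₄)                          ≡⟨ cong₂ (λ a b → a + b + (sum f₃ + sum f₄)) (jacobsthal d≢0) Σf₂ ⟩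
      - + 1 + χ d + (sum f₃ + sum f₄)                              ≡⟨ cong₂ (λ a b → - + 1 + χ d + (a + b)) Σf₃ Σf₄ ⟩
      - + 1 + χ d + (- χ d + 0ℤ)                                   ≡⟨ cancel (χ d) ⟩
      - + 1                                                        ∎
      where
      open ≡-Reasoning
      f₁ f₂ f₃ f₄ : Fin q → ℤ
      f₁ w = χ w * χ (w ⊕ d)
      f₂ w = δ₀ w * χ (w ⊕ d)
      f₃ w = δ₀ (w ⊕ d) * χ w
      f₄ w = δ₀ w * δ₀ (w ⊕ d)
      expand : ∀ a b c e → (a + b) * (c + e) ≡ a * c + b * c + (e * a + b * e)
      expand = solve-∀
      cancel : ∀ x → - + 1 + x + (- x + 0ℤ) ≡ - + 1
      cancel = solve-∀
      Σf₂ : sum f₂ ≡ χ d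
      Σf₂ = trans (sum-delta 0# (λ w → χ (w ⊕ d))) (cong χ (+-identityˡ d))
      Σf₃ : sum f₃ ≡ - χ d
      Σf₃ = trans (sum-pick (λ w → does (w ⊕ d ≟ 0#)) (⊖ d) (dec-true (⊖ d ⊕ d ≟ 0#) (-‿inverseˡ d))
                            (λ w w⊕d≡0 → inverseˡ-unique w d (does⇒ (w ⊕ d ≟ 0#) w⊕d≡0)) χ)
                  (χ-⊖ d)
      Σf₄ : sum f₄ ≡ 0ℤ
      Σf₄ = trans (sum-delta 0# (λ w → δ₀ (w ⊕ d)))
                  (cong ⟦_⟧ (dec-false (0# ⊕ d ≟ 0#) (λ 0⊕d≡0 → d≢0 (trans (sym (+-identityˡ d)) 0⊕d≡0))))

    paley : Matrix (suc q)
    paley zero    _       = + 1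
    paley (suc x) zero    = - + 1
    paley (suc x) (suc y) = signed (lookup (squareBlock F x) y)

    paley-block : ∀ x y → paley (suc x) (suc y) ≡ σ (y ⊕ ⊖ x)
    paley-block x y = cong signed (squareBlock-∋ x y)

    block-sum : ∀ x → sum (λ y → paley (suc x) (suc y)) ≡ + 1
    block-sum x = trans (sum-cong-≗ (paley-block x)) (trans (sum-shift σ (⊖ x)) sum-σ)

    blocks-orthogonal : ∀ {x z} → x ≢ z → sum (λ y → paley (suc x) (suc y) * paley (suc z) (suc y)) ≡ - + 1
    blocks-orthogonal {x} {z} x≢z = begin
      sum (λ y → paley (suc x) (suc y) * paley (suc z) (suc y)) ≡⟨ sum-cong-≗ (λ y → cong₂ _*_ (paley-block x y) (paley-block z y)) ⟩
      sum (λ y → σ (y ⊕ ⊖ x) * σ (y ⊕ ⊖ z))                      ≡⟨ sum-shift (λ y → σ (y ⊕ ⊖ x) * σ (y ⊕ ⊖ z)) x ⟨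
      sum (λ w → σ ((w ⊕ x) ⊕ ⊖ x) * σ ((w ⊕ x) ⊕ ⊖ z))          ≡⟨ sum-cong-≗ (λ w → cong₂ (λ a b → σ a * σ b) (shift-back w) (+-assoc w x (⊖ z))) ⟩
      sum (λ w → σ w * σ (w ⊕ (x ⊕ ⊖ z)))                        ≡⟨ σ-autocorrelation (λ x-z≡0 → x≢z (x∙y⁻¹≈ε⇒x≈y x z x-z≡0)) ⟩
      - + 1                                                      ∎
      where
      open ≡-Reasoning
      shift-back : ∀ w → (w ⊕ x) ⊕ ⊖ x ≡ w
      shift-back w = trans (+-assoc w x (⊖ x)) (trans (cong (w ⊕_) (-‿inverseʳ x)) (+-identityʳ w))

    paley-isHadamard : IsHadamard (suc q) paley
    paley-isHadamard = ±1∧orthogonal⇒isHadamard paley ±1 orthogonal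
      where
      ±1 : ∀ i l → IsSign (paley i l)
      ±1 zero    _       = inj₁ refl
      ±1 (suc x) zero    = inj₂ refl
      ±1 (suc x) (suc y) = signed-isSign (lookup (squareBlock F x) y)
      orthogonal : ∀ i k → i ≢ k → sum (λ l → paley i l * paley k l) ≡ 0ℤ
      orthogonal zero    zero    0≢0 = contradiction refl 0≢0
      orthogonal zero    (suc z) _   = cong (λ s → - + 1 + s) (trans (sum-cong-≗ (λ y → ℤ.*-identityˡ (paley (suc z) (suc y)))) (block-sum z))
      orthogonal (suc x) zero    _   = cong (λ s → - + 1 + s) (trans (sum-cong-≗ (λ y → ℤ.*-identityʳ (paley (suc x) (suc y)))) (block-sum x))
      orthogonal (suc x) (suc z) x≢z = cong (λ s → + 1 + s) (blocks-orthogonal (x≢z ∘ cong suc))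

    switch : Subset q → Fin (suc q) → ℤ
    switch D zero    = - + 1
    switch D (suc y) = signed (not (lookup D y))

    switchedRowSum : Subset q → Fin (suc q) → ℤ
    switchedRowSum D i = sum (λ l → paley i l * switch D l)

    switchedPaley : Subset q → Matrix (suc q)
    switchedPaley D = rescale (signum ∘ switchedRowSum D) (switch D) paley

    switchedPaley-isHadamard : ∀ D → IsHadamard (suc q) (switchedPaley D)
    switchedPaley-isHadamard D = rescale-isHadamard (signum-isSign ∘ switchedRowSum D) switch-±1 paley-isHadamard
      where
      switch-±1 : ∀ l → IsSign (switch D l)
      switch-±1 zero    = inj₂ refl
      switch-±1 (suc y) = signed-isSign (not (lookup D y))

    rowSum-switchedPaley : ∀ D i → rowSum (switchedPaley D) i ≡ + ∣ switchedRowSum D i ∣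
    rowSum-switchedPaley D i = trans (rowSum-rescale (signum ∘ switchedRowSum D) (switch D) paley i) (signum-* (switchedRowSum D i))

    switchedRowSum-zero : ∀ D → switchedRowSum D zero ≡ - + 1 + (+ q - + 2 * + Subset.∣ D ∣)
    switchedRowSum-zero D = cong (λ s → - + 1 + s) (begin
      sum (λ y → + 1 * signed (not (lookup D y)))       ≡⟨ sum-cong-≗ (λ y → trans (ℤ.*-identityˡ _) (signed-not (lookup D y))) ⟩
      sum (λ y → + 1 - + 2 * ⟦ lookup D y ⟧)            ≡⟨ sum-- (λ _ → + 1) (λ y → + 2 * ⟦ lookup D y ⟧) ⟩
      sum {q} (λ _ → + 1) - sum (λ y → + 2 * ⟦ lookup D y ⟧)
        ≡⟨ cong₂ _-_ (sum-ones q) (trans (sum-*ˡ (+ 2) (⟦_⟧ ∘ lookup D)) (cong (+ 2 *_) (sum-subset D))) ⟩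
      + q - + 2 * + Subset.∣ D ∣                        ∎)
      where open ≡-Reasoning

    switchedRowSum-suc : ∀ D x → switchedRowSum D (suc x) ≡
                         + 1 + (+ 1 - + 4 * + Subset.∣ squareBlock F x ∩ D ∣ + + 2 * + Subset.∣ D ∣)
    switchedRowSum-suc D x = cong (λ s → + 1 + s) (begin
      sum (λ y → signed (b y) * signed (not (d y)))                 ≡⟨ sum-cong-≗ (λ y → signed-*-signed-not (b y) (d y)) ⟩
      sum (λ y → signed (b y) - + 4 * (⟦ b y ⟧ * ⟦ d y ⟧) + + 2 * ⟦ d y ⟧)
        ≡⟨ ∑-distrib-+ (λ y → signed (b y) - + 4 * (⟦ b y ⟧ * ⟦ d y ⟧)) (λ y → + 2 * ⟦ d y ⟧) ⟩
      sum (λ y → signed (b y) - + 4 * (⟦ b y ⟧ * ⟦ d y ⟧)) + sum (λ y → + 2 * ⟦ d y ⟧)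
        ≡⟨ cong₂ _+_ (sum-- (signed ∘ b) (λ y → + 4 * (⟦ b y ⟧ * ⟦ d y ⟧))) (sum-*ˡ (+ 2) (⟦_⟧ ∘ d)) ⟩
      sum (signed ∘ b) - sum (λ y → + 4 * (⟦ b y ⟧ * ⟦ d y ⟧)) + + 2 * sum (⟦_⟧ ∘ d)
        ≡⟨ cong₂ (λ s t → sum (signed ∘ b) - s + + 2 * t) (sum-*ˡ (+ 4) (λ y → ⟦ b y ⟧ * ⟦ d y ⟧)) (sum-subset D) ⟩
      sum (signed ∘ b) - + 4 * sum (λ y → ⟦ b y ⟧ * ⟦ d y ⟧) + + 2 * + Subset.∣ D ∣
        ≡⟨ cong₂ (λ s t → s - + 4 * t + + 2 * + Subset.∣ D ∣) (block-sum x) (sum-∩ (squareBlock F x) D) ⟩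
      + 1 - + 4 * + Subset.∣ squareBlock F x ∩ D ∣ + + 2 * + Subset.∣ D ∣ ∎)
      where
      open ≡-Reasoning
      b d : Fin q → Bool
      b = lookup (squareBlock F x)
      d = lookup D

+∣±z∣≡z : ∀ {x z} → 0ℤ ≤ z → x ≡ z ⊎ x ≡ - z → + ∣ x ∣ ≡ z
+∣±z∣≡z 0≤z (inj₁ refl) = ℤ.0≤i⇒+∣i∣≡i 0≤z
+∣±z∣≡z {z = z} 0≤z (inj₂ refl) = trans (cong +_ (ℤ.∣-i∣≡∣i∣ z)) (ℤ.0≤i⇒+∣i∣≡i 0≤z)

module Parameters (m : ℕ) where

  q j : ℕ
  q = 4 ℕ.* m ℕ.* m ℕ.+ 4 ℕ.* m ℕ.+ 3
  j = 2 ℕ.* m ℕ.* m ℕ.+ m ℕ.+ 2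

  intersectionSizes : List ℕ
  intersectionSizes = m ℕ.* m ℕ.+ 1 ∷ m ℕ.* m ℕ.+ 2 ∷ m ℕ.* m ℕ.+ m ℕ.+ 1 ∷ m ℕ.* m ℕ.+ m ℕ.+ 2 ∷ []

  A B : ℤ
  A = + (2 ℕ.* m) - + 2
  B = + (2 ℕ.* m) + + 2

  q≡4[m²+m]+3 : q ≡ 4 ℕ.* (m ℕ.* m ℕ.+ m) ℕ.+ 3
  q≡4[m²+m]+3 = arithmetic m
    where
    arithmetic : ∀ m → 4 ℕ.* m ℕ.* m ℕ.+ 4 ℕ.* m ℕ.+ 3 ≡ 4 ℕ.* (m ℕ.* m ℕ.+ m) ℕ.+ 3
    arithmetic = ℕ-solve-∀

  order : suc q ≡ 4 ℕ.* (m ℕ.* m ℕ.+ m ℕ.+ 1)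
  order = arithmetic m
    where
    arithmetic : ∀ m → suc (4 ℕ.* m ℕ.* m ℕ.+ 4 ℕ.* m ℕ.+ 3) ≡ 4 ℕ.* (m ℕ.* m ℕ.+ m ℕ.+ 1)
    arithmetic = ℕ-solve-∀

  private
    M : ℤ
    M = + m
    +m² : + (m ℕ.* m) ≡ M * M
    +m² = ℤ.pos-* m m
    +j : + j ≡ + 2 * M * M + M + + 2
    +j = cong (λ x → x + M + + 2) (trans (ℤ.pos-* (2 ℕ.* m) m) (cong (_* M) (ℤ.pos-* 2 m)))
    +q : + q ≡ + 4 * M * M + + 4 * M + + 3
    +q = cong₂ (λ x y → x + y + + 3) (trans (ℤ.pos-* (4 ℕ.* m) m) (cong (_* M) (ℤ.pos-* 4 m))) (ℤ.pos-* 4 m)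
    +A : A ≡ + 2 * M - + 2
    +A = cong (_- + 2) (ℤ.pos-* 2 m)
    +B : B ≡ + 2 * M + + 2
    +B = cong (_+ + 2) (ℤ.pos-* 2 m)

  firstRow : - + 1 + (+ q - + 2 * + j) ≡ A
  firstRow = trans (cong₂ (λ x y → - + 1 + (x - + 2 * y)) +q +j) (trans (polynomial M) (sym +A))
    where
    polynomial : ∀ M → - + 1 + ((+ 4 * M * M + + 4 * M + + 3) - + 2 * (+ 2 * M * M + M + + 2)) ≡ + 2 * M - + 2
    polynomial = solve-∀

  blockRow : ℕ → ℤ
  blockRow k = + 1 + (+ 1 - + 4 * + k + + 2 * + j)

  blockRow-m²+1 : blockRow (m ℕ.* m ℕ.+ 1) ≡ B
  blockRow-m²+1 = begin
    blockRow (m ℕ.* m ℕ.+ 1)                                         ≡⟨ cong₂ (λ x y → + 1 + (+ 1 - + 4 * (x + + 1) + + 2 * y)) +m² +j ⟩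
    + 1 + (+ 1 - + 4 * (M * M + + 1) + + 2 * (+ 2 * M * M + M + + 2)) ≡⟨ polynomial M ⟩
    + 2 * M + + 2                                                     ≡⟨ +B ⟨
    B                                                                 ∎
    where
    open ≡-Reasoning
    polynomial : ∀ M → + 1 + (+ 1 - + 4 * (M * M + + 1) + + 2 * (+ 2 * M * M + M + + 2)) ≡ + 2 * M + + 2
    polynomial = solve-∀

  blockRow-m²+2 : blockRow (m ℕ.* m ℕ.+ 2) ≡ A
  blockRow-m²+2 = begin
    blockRow (m ℕ.* m ℕ.+ 2)                                         ≡⟨ cong₂ (λ x y → + 1 + (+ 1 - + 4 * (x + + 2) + + 2 * y)) +m² +j ⟩
    + 1 + (+ 1 - + 4 * (M * M + + 2) + + 2 * (+ 2 * M * M + M + + 2)) ≡⟨ polynomial M ⟩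
    + 2 * M - + 2                                                     ≡⟨ +A ⟨
    A                                                                 ∎
    where
    open ≡-Reasoning
    polynomial : ∀ M → + 1 + (+ 1 - + 4 * (M * M + + 2) + + 2 * (+ 2 * M * M + M + + 2)) ≡ + 2 * M - + 2
    polynomial = solve-∀

  blockRow-m²+m+1 : blockRow (m ℕ.* m ℕ.+ m ℕ.+ 1) ≡ - A
  blockRow-m²+m+1 = begin
    blockRow (m ℕ.* m ℕ.+ m ℕ.+ 1)                                        ≡⟨ cong₂ (λ x y → + 1 + (+ 1 - + 4 * (x + M + + 1) + + 2 * y)) +m² +j ⟩
    + 1 + (+ 1 - + 4 * (M * M + M + + 1) + + 2 * (+ 2 * M * M + M + + 2)) ≡⟨ polynomial M ⟩
    - (+ 2 * M - + 2)                                                      ≡⟨ cong -_ +A ⟨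
    - A                                                                    ∎
    where
    open ≡-Reasoning
    polynomial : ∀ M → + 1 + (+ 1 - + 4 * (M * M + M + + 1) + + 2 * (+ 2 * M * M + M + + 2)) ≡ - (+ 2 * M - + 2)
    polynomial = solve-∀

  blockRow-m²+m+2 : blockRow (m ℕ.* m ℕ.+ m ℕ.+ 2) ≡ - B
  blockRow-m²+m+2 = begin
    blockRow (m ℕ.* m ℕ.+ m ℕ.+ 2)                                        ≡⟨ cong₂ (λ x y → + 1 + (+ 1 - + 4 * (x + M + + 2) + + 2 * y)) +m² +j ⟩
    + 1 + (+ 1 - + 4 * (M * M + M + + 2) + + 2 * (+ 2 * M * M + M + + 2)) ≡⟨ polynomial M ⟩
    - (+ 2 * M + + 2)                                                      ≡⟨ cong -_ +B ⟨
    - B                                                                    ∎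
    where
    open ≡-Reasoning
    polynomial : ∀ M → + 1 + (+ 1 - + 4 * (M * M + M + + 2) + + 2 * (+ 2 * M * M + M + + 2)) ≡ - (+ 2 * M + + 2)
    polynomial = solve-∀

  blockRow-± : ∀ {k} → k ∈ intersectionSizes → (blockRow k ≡ A ⊎ blockRow k ≡ - A) ⊎ (blockRow k ≡ B ⊎ blockRow k ≡ - B)
  blockRow-± (here refl)                         = inj₂ (inj₁ blockRow-m²+1)
  blockRow-± (there (here refl))                 = inj₁ (inj₁ blockRow-m²+2)
  blockRow-± (there (there (here refl)))         = inj₁ (inj₂ blockRow-m²+m+1)
  blockRow-± (there (there (there (here refl)))) = inj₂ (inj₂ blockRow-m²+m+2)

  0≤B : 0ℤ ≤ B
  0≤B = ℤ.+≤+ ℕ.z≤n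

  module _ (1≤m : 1 ℕ.≤ m) where

    0≤A : 0ℤ ≤ A
    0≤A = subst (0ℤ ≤_) (sym (trans (ℤ.[+m]-[+n]≡m⊖n (2 ℕ.* m) 2) (ℤ.⊖-≥ (ℕ.*-monoʳ-≤ 2 1≤m)))) (ℤ.+≤+ ℕ.z≤n)

    +∣A∣≡A : + ∣ A ∣ ≡ A
    +∣A∣≡A = ℤ.0≤i⇒+∣i∣≡i 0≤A

    ∣A∣≢∣B∣ : ∣ A ∣ ≢ ∣ B ∣
    ∣A∣≢∣B∣ ∣A∣≡∣B∣ = contradiction (+-cancelˡ (+ (2 ℕ.* m)) (- + 2) (+ 2) A≡B) λ ()
      where
      A≡B : A ≡ B
      A≡B = trans (sym +∣A∣≡A) (cong +_ ∣A∣≡∣B∣)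

module SwitchedPaleyConstruction (m : ℕ) (F : FiniteField (Parameters.q m)) where

  open Parameters m
  open FiniteFieldProperties F
  open OrderThreeModFour {m ℕ.* m ℕ.+ m} q≡4[m²+m]+3

  switchedPaley-rowSumsAre : 1 ℕ.≤ m → ∀ D → IsIntersectionSet (squareBlock F) j intersectionSizes D → RowSumsAre (switchedPaley D) A B
  switchedPaley-rowSumsAre 1≤m D (∣D∣≡j , _ , sizes , attained) = each-row , (zero , first-row) , B-row
    where
    open ≡-Reasoning
    first-row : rowSum (switchedPaley D) zero ≡ A
    first-row = begin
      rowSum (switchedPaley D) zero     ≡⟨ rowSum-switchedPaley D zero ⟩
      + ∣ switchedRowSum D zero ∣       ≡⟨ cong (+_ ∘ ∣_∣) (trans (switchedRowSum-zero D) (cong (λ n → - + 1 + (+ q - + 2 * + n)) ∣D∣≡j)) ⟩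
      + ∣ - + 1 + (+ q - + 2 * + j) ∣   ≡⟨ cong (+_ ∘ ∣_∣) firstRow ⟩
      + ∣ A ∣                           ≡⟨ +∣A∣≡A 1≤m ⟩
      A                                 ∎
    block-row : ∀ x → rowSum (switchedPaley D) (suc x) ≡ + ∣ blockRow Subset.∣ squareBlock F x ∩ D ∣ ∣
    block-row x = trans (rowSum-switchedPaley D (suc x)) (cong (+_ ∘ ∣_∣)
      (trans (switchedRowSum-suc D x) (cong (λ n → + 1 + (+ 1 - + 4 * + Subset.∣ squareBlock F x ∩ D ∣ + + 2 * + n)) ∣D∣≡j)))
    each-row : ∀ i → rowSum (switchedPaley D) i ≡ A ⊎ rowSum (switchedPaley D) i ≡ B
    each-row zero = inj₁ first-row
    each-row (suc x) = [ (λ ±A → inj₁ (trans (block-row x) (+∣±z∣≡z (0≤A 1≤m) ±A))) ,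
                         (λ ±B → inj₂ (trans (block-row x) (+∣±z∣≡z 0≤B ±B))) ]′ (blockRow-± (sizes x))
    B-row : ∃ λ i → rowSum (switchedPaley D) i ≡ B
    B-row = let x , ∣Bx∩D∣≡m²+1 = attained (m ℕ.* m ℕ.+ 1) (here refl) in
            suc x , trans (block-row x) (+∣±z∣≡z 0≤B (inj₁ (trans (cong blockRow ∣Bx∩D∣≡m²+1) blockRow-m²+1)))

proposition4p1 : (m : ℕ) (F : FiniteField (4 ℕ.* m ℕ.* m ℕ.+ 4 ℕ.* m ℕ.+ 3)) →
    (D : Subset (4 ℕ.* m ℕ.* m ℕ.+ 4 ℕ.* m ℕ.+ 3)) →
    IsIntersectionSet (squareBlock F) (2 ℕ.* m ℕ.* m ℕ.+ m ℕ.+ 2)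
      (m ℕ.* m ℕ.+ 1 ∷ m ℕ.* m ℕ.+ 2 ∷ m ℕ.* m ℕ.+ m ℕ.+ 1 ∷ m ℕ.* m ℕ.+ m ℕ.+ 2 ∷ []) D →
    Σ (Matrix (4 ℕ.* (m ℕ.* m ℕ.+ m ℕ.+ 1))) λ H →
      IsHadamard (4 ℕ.* (m ℕ.* m ℕ.+ m ℕ.+ 1)) H × IsBiregular H ×
      RowSumsAre H (+ (2 ℕ.* m) - + 2) (+ (2 ℕ.* m) + + 2)
-- for m = 0 the listed sizes m² + 1 and m² + m + 1 coincide
proposition4p1 zero F D (_ , ((_ ∷ 1≢1 ∷ _) ∷ _) , _) = contradiction refl 1≢1
proposition4p1 m@(suc _) F D hyp =
  subst (λ n → Σ (Matrix n) λ H → IsHadamard n H × IsBiregular H × RowSumsAre H A B) order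
        (switchedPaley D , switchedPaley-isHadamard D , (∣ A ∣ , ∣ B ∣ , ∣A∣≢∣B∣ 1≤m , biregular) , rowSums)
  where
  open Parameters m
  open FiniteFieldProperties F
  open OrderThreeModFour {m ℕ.* m ℕ.+ m} q≡4[m²+m]+3
  open SwitchedPaleyConstruction m F
  1≤m : 1 ℕ.≤ m
  1≤m = ℕ.s≤s ℕ.z≤n
  rowSums : RowSumsAre (switchedPaley D) A B
  rowSums = switchedPaley-rowSumsAre 1≤m D hyp
  biregular : RowSumsAre (switchedPaley D) (+ ∣ A ∣) (+ ∣ B ∣)
  biregular = subst (λ a → RowSumsAre (switchedPaley D) a B) (sym (+∣A∣≡A 1≤m)) rowSums
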